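{- For all nonnegative integers $k$ and $n$, $S_{n+2,k+1}=S_{n+1,k}+S_{n,k}$, where $S_{n,k}=\sum_{j=0}^{k}\binom{k}{j}q(n-k-j)$.
   Context: $q(n)$ denotes the number of partitions of the positive integer $n$ into odd parts; $q(0)=1$ and $q(n)=0$ for negative $n$. -}

module Defs where

open import Data.Nat using (ℕ; zero; suc; _+_; _*_; _∸_; _≤?_)
open import Data.Nat.Combinatorics using (_C_)
open import Data.Integer using (ℤ; +_; -[1+_]; _-_)
open import Data.Nat.ListAction using (sum)
open import Data.List using (List; []; _∷_; map; upTo; length)
open import Relation.Nullary using (yes; no)

-- Partitions of n into odd parts, listed as non-increasing lists of
-- (odd) parts.  oddPartitionsAux fuel n m lists the partitions of n whose
-- parts all lie in {1, 3, ..., 2m-1}, written with parts non-increasing.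
-- The fuel (≥ n) only ensures structural termination: every part is ≥ 1.
oddPartitionsAux : ℕ → ℕ → ℕ → List (List ℕ)
oddPartitionsAux _        zero     _       = [] ∷ []
oddPartitionsAux zero     (suc n)  _       = []
oddPartitionsAux (suc f)  (suc n)  zero    = []
oddPartitionsAux (suc f)  (suc n)  (suc m) with 2 * m + 1 ≤? suc n
... | yes _ = map (λ π → (2 * m + 1) ∷ π) (oddPartitionsAux f (suc n ∸ (2 * m + 1)) (suc m))
              Data.List.++ oddPartitionsAux (suc f) (suc n) m
... | no _  = oddPartitionsAux (suc f) (suc n) m

-- All partitions of n into odd parts (the largest possible odd part is ≤ 2n-1).
oddPartitions : ℕ → List (List ℕ)
oddPartitions n = oddPartitionsAux n n n

qℕ : ℕ → ℕ
qℕ n = length (oddPartitions n)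

q : ℤ → ℕ
q (+ n)      = qℕ n
q -[1+ _ ]   = 0

S : ℕ → ℕ → ℕ
S n k = sum (map (λ j → (k C j) * q ((+ n - + k) - + j)) (upTo (suc k)))

{-# OPTIONS --safe #-}
module Submission where

open import Defs
open import Data.Nat using (ℕ; zero; suc; _+_; _*_)
open import Data.Nat.Properties using (+-assoc; +-comm; +-identityʳ; *-distribʳ-+; n<1+n)
open import Data.Nat.Combinatorics using (_C_; nCk+nC[k+1]≡[n+1]C[k+1]; k>n⇒nCk≡0)
open import Data.Nat.ListAction using (sum)
open import Data.Nat.ListAction.Properties using (sum-++)
open import Data.List using (map; upTo; applyUpTo; _++_; [_])
open import Data.List.Properties using (applyUpTo-∷ʳ; map-upTo; map-cong)
open import Data.Integer using (ℤ; 1ℤ; _-_) renaming (_+_ to _+ℤ_; +_ to pos)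
open import Data.Integer.Tactic.RingSolver using (solve-∀)
open import Relation.Binary.PropositionalEquality
  using (_≡_; refl; cong; cong₂; sym; module ≡-Reasoning)
open import Function using (_∘_)

open ≡-Reasoning

sum-applyUpTo-cong : ∀ {f g : ℕ → ℕ} m → (∀ j → f j ≡ g j) →
                     sum (applyUpTo f m) ≡ sum (applyUpTo g m)
sum-applyUpTo-cong zero    f≗g = refl
sum-applyUpTo-cong (suc m) f≗g = cong₂ _+_ (f≗g 0) (sum-applyUpTo-cong m (f≗g ∘ suc))

sum-applyUpTo-+ : ∀ (f g : ℕ → ℕ) m →
                  sum (applyUpTo (λ j → f j + g j) m) ≡ sum (applyUpTo f m) + sum (applyUpTo g m)
sum-applyUpTo-+ f g zero    = refl
sum-applyUpTo-+ f g (suc m) = begin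
  (f 0 + g 0) + sum (applyUpTo (λ j → f (suc j) + g (suc j)) m)
    ≡⟨ cong ((f 0 + g 0) +_) (sum-applyUpTo-+ (f ∘ suc) (g ∘ suc) m) ⟩
  (f 0 + g 0) + (F′ + G′)   ≡⟨ +-assoc (f 0) (g 0) (F′ + G′) ⟩
  f 0 + (g 0 + (F′ + G′))   ≡⟨ cong (f 0 +_) (sym (+-assoc (g 0) F′ G′)) ⟩
  f 0 + ((g 0 + F′) + G′)   ≡⟨ cong (λ x → f 0 + (x + G′)) (+-comm (g 0) F′) ⟩
  f 0 + ((F′ + g 0) + G′)   ≡⟨ cong (f 0 +_) (+-assoc F′ (g 0) G′) ⟩
  f 0 + (F′ + (g 0 + G′))   ≡⟨ sym (+-assoc (f 0) F′ (g 0 + G′)) ⟩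
  (f 0 + F′) + (g 0 + G′)   ∎
  where
  F′ G′ : ℕ
  F′ = sum (applyUpTo (f ∘ suc) m)
  G′ = sum (applyUpTo (g ∘ suc) m)

sum-applyUpTo-last : ∀ (f : ℕ → ℕ) m → sum (applyUpTo f (suc m)) ≡ sum (applyUpTo f m) + f m
sum-applyUpTo-last f m = begin
  sum (applyUpTo f (suc m))            ≡⟨ cong sum (applyUpTo-∷ʳ f m) ⟨
  sum (applyUpTo f m ++ [ f m ])       ≡⟨ sum-++ (applyUpTo f m) [ f m ] ⟩
  sum (applyUpTo f m) + (f m + 0)      ≡⟨ cong (sum (applyUpTo f m) +_) (+-identityʳ (f m)) ⟩
  sum (applyUpTo f m) + f m            ∎

binomialSum : ℕ → (ℕ → ℕ) → ℕ
binomialSum k F = sum (map (λ j → (k C j) * F j) (upTo (suc k)))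

binomialSum-applyUpTo : ∀ k F → binomialSum k F ≡ sum (applyUpTo (λ j → (k C j) * F j) (suc k))
binomialSum-applyUpTo k F = cong sum (map-upTo (λ j → (k C j) * F j) (suc k))

binomialSum-cong : ∀ k {F G : ℕ → ℕ} → (∀ j → F j ≡ G j) → binomialSum k F ≡ binomialSum k G
binomialSum-cong k F≗G = cong sum (map-cong (λ j → cong ((k C j) *_) (F≗G j)) (upTo (suc k)))

-- Pascal's rule splits each coefficient; the top term of the second sum vanishes since C(k,k+1) = 0.
binomialSum-suc : ∀ k F → binomialSum (suc k) F ≡ binomialSum k F + binomialSum k (F ∘ suc)
binomialSum-suc k F = begin
  binomialSum (suc k) F
    ≡⟨ binomialSum-applyUpTo (suc k) F ⟩
  1 * F 0 + sum (applyUpTo (λ j → (suc k C suc j) * F (suc j)) (suc k))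
    ≡⟨ cong (1 * F 0 +_) (sum-applyUpTo-cong (suc k) pascal) ⟩
  1 * F 0 + sum (applyUpTo (λ j → (k C j) * F (suc j) + (k C suc j) * F (suc j)) (suc k))
    ≡⟨ cong (1 * F 0 +_) (sum-applyUpTo-+ (λ j → (k C j) * F (suc j)) upper (suc k)) ⟩
  1 * F 0 + (A + sum (applyUpTo upper (suc k)))
    ≡⟨ cong (λ x → 1 * F 0 + (A + x)) upper-sum ⟩
  1 * F 0 + (A + U)
    ≡⟨ cong (1 * F 0 +_) (+-comm A U) ⟩
  1 * F 0 + (U + A)
    ≡⟨ sym (+-assoc (1 * F 0) U A) ⟩
  (1 * F 0 + U) + A
    ≡⟨ cong₂ _+_ (binomialSum-applyUpTo k F) (binomialSum-applyUpTo k (F ∘ suc)) ⟨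
  binomialSum k F + binomialSum k (F ∘ suc) ∎
  where
  upper : ℕ → ℕ
  upper j = (k C suc j) * F (suc j)
  A U : ℕ
  A = sum (applyUpTo (λ j → (k C j) * F (suc j)) (suc k))
  U = sum (applyUpTo upper k)

  pascal : ∀ j → (suc k C suc j) * F (suc j) ≡ (k C j) * F (suc j) + (k C suc j) * F (suc j)
  pascal j = begin
    (suc k C suc j) * F (suc j)                  ≡⟨ cong (_* F (suc j)) (nCk+nC[k+1]≡[n+1]C[k+1] k j) ⟨
    (k C j + k C suc j) * F (suc j)              ≡⟨ *-distribʳ-+ (F (suc j)) (k C j) (k C suc j) ⟩
    (k C j) * F (suc j) + (k C suc j) * F (suc j) ∎

  upper-sum : sum (applyUpTo upper (suc k)) ≡ U
  upper-sum = begin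
    sum (applyUpTo upper (suc k))  ≡⟨ sum-applyUpTo-last upper k ⟩
    U + (k C suc k) * F (suc k)    ≡⟨ cong (λ c → U + c * F (suc k)) (k>n⇒nCk≡0 (n<1+n k)) ⟩
    U + 0                          ≡⟨ +-identityʳ U ⟩
    U                              ∎

-- pos (suc n) unfolds to 1ℤ +ℤ pos n, so these solver instances apply to the indices of S.
shift-index : ∀ (n k j : ℤ) → ((1ℤ +ℤ (1ℤ +ℤ n)) - (1ℤ +ℤ k)) - j ≡ ((1ℤ +ℤ n) - k) - j
shift-index = solve-∀

shift-index-suc : ∀ (n k j : ℤ) → ((1ℤ +ℤ (1ℤ +ℤ n)) - (1ℤ +ℤ k)) - (1ℤ +ℤ j) ≡ (n - k) - j
shift-index-suc = solve-∀

lemma1 : (k n : ℕ) → S (suc (suc n)) (suc k) ≡ S (suc n) k + S n k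
lemma1 k n = begin
  binomialSum (suc k) F                       ≡⟨ binomialSum-suc k F ⟩
  binomialSum k F + binomialSum k (F ∘ suc)   ≡⟨ cong₂ _+_ (binomialSum-cong k first) (binomialSum-cong k second) ⟩
  S (suc n) k + S n k                         ∎
  where
  F : ℕ → ℕ
  F j = q ((pos (suc (suc n)) - pos (suc k)) - pos j)
  first : ∀ j → F j ≡ q ((pos (suc n) - pos k) - pos j)
  first j = cong q (shift-index (pos n) (pos k) (pos j))
  second : ∀ j → F (suc j) ≡ q ((pos n - pos k) - pos j)
  second j = cong q (shift-index-suc (pos n) (pos k) (pos j))
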